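{- Let $n$ be a power of two, $\alpha\in(0,1)$ with $n^{1-\alpha}$ a power of two, $\delta>0$, and let $A,B$ be $n\times n$ $\delta$-bounded-difference matrices with $C=A\star B$. For $i,j,k\in[n]$, if $C_{i,j}=A_{i,k}+B_{k,j}$, then $k'\in K(i',j')$.
   Context: A matrix $X$ is $\delta$-bounded-difference if for all $i,j$ (whenever the entries exist) $|X_{i,j}-X_{i,j+1}|<\delta$ and $|X_{i,j}-X_{i+1,j}|<\delta$. The min-plus product is $(A\star B)_{i,j}=\min_{k\in[n]}\{A_{i,k}+B_{k,j}\}$, with $[n]=\{1,\dots,n\}$. Partition $[n]$ into consecutive intervals of length $n^{1-\alpha}$; for $i\in[n]$, $I(i)$ is the interval containing $i$ and $i'$ is the smallest element of $I(i)$ (similarly $j',k'$). Let $[n]'=\{1,n^{1-\alpha}+1,\dots,n-n^{1-\alpha}+1\}$, $\tilde C_{i,j}=\min_{k'\in[n]'}\{A_{i',k'}+B_{k',j'}\}$, and define the candidate set $K(i',j')=\{k'\in[n]' : A_{i',k'}+B_{k',j'}\le \tilde C_{i',j'}+8\delta n^{1-\alpha}\}$.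
   Formalization: The entries of the matrices A and B, the bound δ and the parameter α are all taken in the rationals ℚ. -}

module Defs where

open import Data.Nat as ℕ using (ℕ; zero; suc; _^_; _∸_)
open import Data.Nat.Properties using (m^n≢0)
open import Data.Nat.DivMod using (_/_)
open import Data.Integer using (+_)
open import Data.Rational as ℚ using (ℚ; _+_; _-_; _*_; _⊓_; ∣_∣)
open import Data.Product using (Σ; _×_)
open import Relation.Binary.PropositionalEquality using (_≡_)

ℕ→ℚ : ℕ → ℚ
ℕ→ℚ m = (+ m) ℚ./ 1

-- matrices are functions ℕ → ℕ → ℚ; only entries with indices < n matter
-- (indices are 0-based: the paper's [n] = {1,…,n} corresponds to {0,…,n-1})
Matrix : Set
Matrix = ℕ → ℕ → ℚ

BoundedDiff : ℕ → ℚ → Matrix → Set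
BoundedDiff n δ X =
  (∀ i j → i ℕ.< n → suc j ℕ.< n → ∣ X i j - X i (suc j) ∣ ℚ.< δ) ×
  (∀ i j → suc i ℕ.< n → j ℕ.< n → ∣ X i j - X (suc i) j ∣ ℚ.< δ)

minUpTo : (ℕ → ℚ) → ℕ → ℚ
minUpTo f zero    = f zero
minUpTo f (suc m) = minUpTo f m ⊓ f (suc m)

-- min-plus product (A ⋆ B)_{i,j} = min_{k<n} (A_{i,k} + B_{k,j})   (n ≥ 1)
minPlus : ℕ → Matrix → Matrix → Matrix
minPlus n A B i j = minUpTo (λ k → A i k + B k j) (n ∸ 1)

-- block length L = 2^q (= n^{1-α})
blockLen : ℕ → ℕ
blockLen q = 2 ^ q

-- i' : smallest element of the block (interval of length 2^q) containing i
blockStart : ℕ → ℕ → ℕ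
blockStart q i = (_/_ i (2 ^ q) {{m^n≢0 2 q}}) ℕ.* 2 ^ q

InBlockStarts : ℕ → ℕ → ℕ → Set
InBlockStarts n q k' = Σ ℕ (λ t → (t ℕ.< _/_ n (2 ^ q) {{m^n≢0 2 q}}) × (k' ≡ t ℕ.* 2 ^ q))

-- C̃_{i,j} = min_{k' ∈ [n]'} (A_{i,k'} + B_{k',j})
Ctilde : ℕ → ℕ → Matrix → Matrix → Matrix
Ctilde n q A B i j =
  minUpTo (λ t → A i (t ℕ.* 2 ^ q) + B (t ℕ.* 2 ^ q) j) (_/_ n (2 ^ q) {{m^n≢0 2 q}} ∸ 1)

InK : ℕ → ℕ → ℚ → Matrix → Matrix → ℕ → ℕ → ℕ → Set
InK n q δ A B i' j' k' =
  InBlockStarts n q k' ×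
  (A i' k' + B k' j' ℚ.≤ Ctilde n q A B i' j' + ℕ→ℚ 8 * δ * ℕ→ℚ (2 ^ q))

{-# OPTIONS --safe #-}
module Submission where

open import Defs
open import Data.Nat as ℕ using (ℕ; _^_)
open import Data.Rational as ℚ using (ℚ; 0ℚ; 1ℚ; _+_; _-_; _*_)
open import Relation.Binary.PropositionalEquality using (_≡_)

open import Level using (0ℓ)
open import Data.Nat using (zero; suc; z≤n; s≤s; _∸_; NonZero)
open import Data.Nat.Properties as ℕ
  using (≤-<-trans; m≤n+m; m^n≢0; ^-distribˡ-+-*; m+[n∸m]≡n; *-monoˡ-<; m≤n⇒m<n∨m≡n; m<n⇒m<1+n)
open import Data.Nat.DivMod using (_/_; _%_; m≡m%n+[m/n]*n; m%n<n; m*n/n≡m; m/n*n≡m; m/n*n≤m; m<n*o⇒m/o<n)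
open import Data.Nat.Divisibility using (_∣_; m∣m*n)
open import Data.Nat.Coprimality as Coprime using (1-coprimeTo)
open import Data.Integer as ℤ using (+_; -[1+_])
import Data.Integer.Properties as ℤ
open import Data.Rational using (mkℚ; -_; ∣_∣; *≤*; nonNegative)
open import Data.Rational.Properties
  using ( ≤-refl; ≤-trans; ≤-reflexive; <⇒≤; +-mono-≤; +-monoˡ-≤; +-monoʳ-≤; neg-antimono-≤
        ; *-monoʳ-≤-nonNeg; *-monoˡ-≤-nonNeg; *-identityʳ; *-zeroˡ; +-inverseʳ
        ; ∣-p∣≡∣p∣; ∣p+q∣≤∣p∣+∣q∣; normalize-coprime; drop-*≤*
        ; p⊓q≤p; p⊓q≤q; ⊓-sel; +-*-commutativeRing; _≟_; module ≤-Reasoning)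
open import Data.Product using (∃-syntax; _×_; _,_; proj₁; proj₂)
open import Data.Sum using (inj₁; inj₂)
open import Relation.Nullary.Decidable using (dec⇒maybe)
open import Relation.Binary.PropositionalEquality using (refl; sym; trans; cong; cong₂; subst; subst₂; module ≡-Reasoning)
open import Tactic.RingSolver using (solve-∀)
open import Tactic.RingSolver.Core.AlmostCommutativeRing using (AlmostCommutativeRing; fromCommutativeRing)

-- Moving an index within its block of length L changes an entry of a δ-bounded-difference
-- matrix by at most Lδ, so replacing i, k, j by their block starts changes the path weight
-- A i k + B k j by at most 4Lδ. For an optimal k this gives A i′ k′ + B k′ j′ ≤ C i j + 4Lδ;
-- for the block start s attaining C̃ i′ j′ it gives C i j ≤ A i s + B s j ≤ C̃ i′ j′ + 4Lδ.
-- Adding the two bounds yields the slack 8δL, and L ∣ n (as q ≤ p) makes k′ a valid block start.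

ℚ-ring : AlmostCommutativeRing 0ℓ 0ℓ
ℚ-ring = fromCommutativeRing +-*-commutativeRing (λ x → dec⇒maybe (0ℚ ≟ x))

p≤∣p∣ : ∀ p → p ℚ.≤ ∣ p ∣
p≤∣p∣ (mkℚ (+ _)    _ _) = ≤-refl
p≤∣p∣ (mkℚ -[1+ _ ] _ _) = *≤* ℤ.-≤+

∣p-q∣≡∣q-p∣ : ∀ p q → ∣ p - q ∣ ≡ ∣ q - p ∣
∣p-q∣≡∣q-p∣ p q = begin
  ∣ p - q ∣       ≡⟨ ∣-p∣≡∣p∣ (p - q) ⟨
  ∣ - (p - q) ∣   ≡⟨ cong ∣_∣ (-[p-q]≡q-p p q) ⟩
  ∣ q - p ∣       ∎
  where
  open ≡-Reasoning
  -[p-q]≡q-p : ∀ p q → - (p - q) ≡ q - p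
  -[p-q]≡q-p = solve-∀ ℚ-ring

∣p-q∣≤r⇒p≤q+r : ∀ {p q r} → ∣ p - q ∣ ℚ.≤ r → p ℚ.≤ q + r
∣p-q∣≤r⇒p≤q+r {p} {q} {r} ∣p-q∣≤r = begin
  p             ≡⟨ p≡q+[p-q] p q ⟩
  q + (p - q)   ≤⟨ +-monoʳ-≤ q (≤-trans (p≤∣p∣ (p - q)) ∣p-q∣≤r) ⟩
  q + r         ∎
  where
  open ≤-Reasoning
  p≡q+[p-q] : ∀ p q → p ≡ q + (p - q)
  p≡q+[p-q] = solve-∀ ℚ-ring

∣p-q∣≤r⇒q≤p+r : ∀ {p q r} → ∣ p - q ∣ ℚ.≤ r → q ℚ.≤ p + r
∣p-q∣≤r⇒q≤p+r {p} {q} ∣p-q∣≤r = ∣p-q∣≤r⇒p≤q+r (subst (ℚ._≤ _) (∣p-q∣≡∣q-p∣ p q) ∣p-q∣≤r)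

∣p-r∣≤∣p-q∣+∣q-r∣ : ∀ p q r → ∣ p - r ∣ ℚ.≤ ∣ p - q ∣ + ∣ q - r ∣
∣p-r∣≤∣p-q∣+∣q-r∣ p q r =
  subst (λ x → ∣ x ∣ ℚ.≤ ∣ p - q ∣ + ∣ q - r ∣) (telescope p q r) (∣p+q∣≤∣p∣+∣q∣ (p - q) (q - r))
  where
  telescope : ∀ p q r → (p - q) + (q - r) ≡ p - r
  telescope = solve-∀ ℚ-ring

∣p+q-[r+s]∣≤∣p-r∣+∣q-s∣ : ∀ p q r s → ∣ (p + q) - (r + s) ∣ ℚ.≤ ∣ p - r ∣ + ∣ q - s ∣
∣p+q-[r+s]∣≤∣p-r∣+∣q-s∣ p q r s =
  subst (λ x → ∣ x ∣ ℚ.≤ ∣ p - r ∣ + ∣ q - s ∣) (regroup p q r s) (∣p+q∣≤∣p∣+∣q∣ (p - r) (q - s))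
  where
  regroup : ∀ p q r s → (p - r) + (q - s) ≡ (p + q) - (r + s)
  regroup = solve-∀ ℚ-ring

ℕ→ℚ≡mkℚ : ∀ m → ℕ→ℚ m ≡ mkℚ (+ m) 0 (Coprime.sym (1-coprimeTo m))
ℕ→ℚ≡mkℚ m = normalize-coprime (Coprime.sym (1-coprimeTo m))

ℕ→ℚ-suc : ∀ m → ℕ→ℚ (suc m) ≡ 1ℚ + ℕ→ℚ m
ℕ→ℚ-suc m rewrite ℕ→ℚ≡mkℚ m = cong (λ z → (+ 1 ℤ.+ z) ℚ./ 1) (sym (ℤ.*-identityʳ (+ m)))

ℕ→ℚ-mono-≤ : ∀ {m k} → m ℕ.≤ k → ℕ→ℚ m ℚ.≤ ℕ→ℚ k
ℕ→ℚ-mono-≤ {m} {k} m≤k rewrite ℕ→ℚ≡mkℚ m | ℕ→ℚ≡mkℚ k =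
  *≤* (subst₂ ℤ._≤_ (sym (ℤ.*-identityʳ (+ m))) (sym (ℤ.*-identityʳ (+ k))) (ℤ.+≤+ m≤k))

ℕ→ℚ-cancel-≤ : ∀ {m k} → ℕ→ℚ m ℚ.≤ ℕ→ℚ k → m ℕ.≤ k
ℕ→ℚ-cancel-≤ {m} {k} m≤k rewrite ℕ→ℚ≡mkℚ m | ℕ→ℚ≡mkℚ k =
  ℤ.drop‿+≤+ (subst₂ ℤ._≤_ (ℤ.*-identityʳ (+ m)) (ℤ.*-identityʳ (+ k)) (drop-*≤* m≤k))

∣f[0]-f[d]∣≤d*δ : ∀ (f : ℕ → ℚ) {δ} d → (∀ t → t ℕ.< d → ∣ f t - f (suc t) ∣ ℚ.≤ δ) →
                  ∣ f 0 - f d ∣ ℚ.≤ ℕ→ℚ d * δ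
∣f[0]-f[d]∣≤d*δ f {δ} zero _ = ≤-reflexive (begin
  ∣ f 0 - f 0 ∣  ≡⟨ cong ∣_∣ (+-inverseʳ (f 0)) ⟩
  0ℚ             ≡⟨ *-zeroˡ δ ⟨
  0ℚ * δ         ∎)
  where open ≡-Reasoning
∣f[0]-f[d]∣≤d*δ f {δ} (suc d) step = begin
  ∣ f 0 - f (suc d) ∣                  ≤⟨ ∣p-r∣≤∣p-q∣+∣q-r∣ (f 0) (f d) (f (suc d)) ⟩
  ∣ f 0 - f d ∣ + ∣ f d - f (suc d) ∣  ≤⟨ +-mono-≤ (∣f[0]-f[d]∣≤d*δ f d (λ t t<d → step t (m<n⇒m<1+n t<d)))
                                                  (step d ℕ.≤-refl) ⟩
  ℕ→ℚ d * δ + δ                        ≡⟨ [1+d]δ≡dδ+δ (ℕ→ℚ d) δ ⟨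
  (1ℚ + ℕ→ℚ d) * δ                     ≡⟨ cong (_* δ) (ℕ→ℚ-suc d) ⟨
  ℕ→ℚ (suc d) * δ                      ∎
  where
  open ≤-Reasoning
  [1+d]δ≡dδ+δ : ∀ d δ → (1ℚ + d) * δ ≡ d * δ + δ
  [1+d]δ≡dδ+δ = solve-∀ ℚ-ring

module _ {n : ℕ} {δ : ℚ} (X : Matrix) (bd : BoundedDiff n δ X) where

  BoundedDiff-lipschitz : ∀ {a b} r s → r ℕ.+ a ℕ.< n → s ℕ.+ b ℕ.< n →
                          ∣ X a b - X (r ℕ.+ a) (s ℕ.+ b) ∣ ℚ.≤ ℕ→ℚ s * δ + ℕ→ℚ r * δ
  BoundedDiff-lipschitz {a} {b} r s r+a<n s+b<n = begin
    ∣ X a b - X (r ℕ.+ a) (s ℕ.+ b) ∣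
      ≤⟨ ∣p-r∣≤∣p-q∣+∣q-r∣ (X a b) (X a (s ℕ.+ b)) (X (r ℕ.+ a) (s ℕ.+ b)) ⟩
    ∣ X a b - X a (s ℕ.+ b) ∣ + ∣ X a (s ℕ.+ b) - X (r ℕ.+ a) (s ℕ.+ b) ∣
      ≤⟨ +-mono-≤ along-row along-column ⟩
    ℕ→ℚ s * δ + ℕ→ℚ r * δ
      ∎
    where
    open ≤-Reasoning
    along-row : ∣ X a (0 ℕ.+ b) - X a (s ℕ.+ b) ∣ ℚ.≤ ℕ→ℚ s * δ
    along-row = ∣f[0]-f[d]∣≤d*δ (λ t → X a (t ℕ.+ b)) s λ t t<s →
      <⇒≤ (proj₁ bd a (t ℕ.+ b) (≤-<-trans (m≤n+m a r) r+a<n) (≤-<-trans (ℕ.+-monoˡ-≤ b t<s) s+b<n))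
    along-column : ∣ X (0 ℕ.+ a) (s ℕ.+ b) - X (r ℕ.+ a) (s ℕ.+ b) ∣ ℚ.≤ ℕ→ℚ r * δ
    along-column = ∣f[0]-f[d]∣≤d*δ (λ t → X (t ℕ.+ a) (s ℕ.+ b)) r λ t t<r →
      <⇒≤ (proj₂ bd (t ℕ.+ a) (s ℕ.+ b) (≤-<-trans (ℕ.+-monoˡ-≤ a t<r) r+a<n) s+b<n)

  BoundedDiff-block-corner : 0ℚ ℚ.≤ δ → ∀ L .{{_ : NonZero L}} {a b} → a ℕ.< n → b ℕ.< n →
                             ∣ X (a / L ℕ.* L) (b / L ℕ.* L) - X a b ∣ ℚ.≤ ℕ→ℚ L * δ + ℕ→ℚ L * δ
  BoundedDiff-block-corner 0≤δ L {a} {b} a<n b<n = begin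
    ∣ X (a / L ℕ.* L) (b / L ℕ.* L) - X a b ∣
      ≡⟨ cong₂ (λ x y → ∣ X (a / L ℕ.* L) (b / L ℕ.* L) - X x y ∣) (m≡m%n+[m/n]*n a L) (m≡m%n+[m/n]*n b L) ⟩
    ∣ X (a / L ℕ.* L) (b / L ℕ.* L) - X (a % L ℕ.+ a / L ℕ.* L) (b % L ℕ.+ b / L ℕ.* L) ∣
      ≤⟨ BoundedDiff-lipschitz (a % L) (b % L) (subst (ℕ._< n) (m≡m%n+[m/n]*n a L) a<n)
                                               (subst (ℕ._< n) (m≡m%n+[m/n]*n b L) b<n) ⟩
    ℕ→ℚ (b % L) * δ + ℕ→ℚ (a % L) * δ
      ≤⟨ +-mono-≤ (remainder-bound b) (remainder-bound a) ⟩
    ℕ→ℚ L * δ + ℕ→ℚ L * δ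
      ∎
    where
    open ≤-Reasoning
    remainder-bound : ∀ x → ℕ→ℚ (x % L) * δ ℚ.≤ ℕ→ℚ L * δ
    remainder-bound x = *-monoʳ-≤-nonNeg δ {{nonNegative 0≤δ}} (ℕ→ℚ-mono-≤ (ℕ.<⇒≤ (m%n<n x L)))

m<n⇒m≤n∸1 : ∀ {m n} → m ℕ.< n → m ℕ.≤ n ∸ 1
m<n⇒m≤n∸1 (s≤s m≤n) = m≤n

m≤n/o∸1⇒m*o<n : ∀ {m n o} .{{_ : NonZero o}} → 0 ℕ.< n → m ℕ.≤ n / o ∸ 1 → m ℕ.* o ℕ.< n
m≤n/o∸1⇒m*o<n {m} {n} {o} 0<n m≤ with n / o in n/o≡
... | zero  with z≤n ← m≤ = 0<n
... | suc t = begin-strict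
  m ℕ.* o      <⟨ *-monoˡ-< o (s≤s m≤) ⟩
  suc t ℕ.* o  ≡⟨ cong (ℕ._* o) n/o≡ ⟨
  n / o ℕ.* o  ≤⟨ m/n*n≤m n o ⟩
  n            ∎
  where open ℕ.≤-Reasoning

m*n/n*n≡m*n : ∀ m n .{{_ : NonZero n}} → m ℕ.* n / n ℕ.* n ≡ m ℕ.* n
m*n/n*n≡m*n m n = cong (ℕ._* n) (m*n/n≡m m n)

m<n∧o∣n⇒m/o<n/o : ∀ {m n o} .{{_ : NonZero o}} → o ∣ n → m ℕ.< n → m / o ℕ.< n / o
m<n∧o∣n⇒m/o<n/o o∣n m<n = m<n*o⇒m/o<n (subst (_ ℕ.<_) (sym (m/n*n≡m o∣n)) m<n)

^-monoʳ-∣ : ∀ m {p q} → q ℕ.≤ p → m ^ q ∣ m ^ p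
^-monoʳ-∣ m {p} {q} q≤p = subst (m ^ q ∣_) m^q*m^[p∸q]≡m^p (m∣m*n (m ^ (p ∸ q)))
  where
  m^q*m^[p∸q]≡m^p : m ^ q ℕ.* m ^ (p ∸ q) ≡ m ^ p
  m^q*m^[p∸q]≡m^p = trans (sym (^-distribˡ-+-* m q (p ∸ q))) (cong (m ^_) (m+[n∸m]≡n q≤p))

blockStart∈InBlockStarts : ∀ {n} q {k} → 2 ^ q ∣ n → k ℕ.< n → InBlockStarts n q (blockStart q k)
blockStart∈InBlockStarts q {k} 2^q∣n k<n = k / 2 ^ q , m<n∧o∣n⇒m/o<n/o 2^q∣n k<n , refl
  where instance _ = m^n≢0 2 q

minUpTo-≤ : ∀ f {m s} → s ℕ.≤ m → minUpTo f m ℚ.≤ f s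
minUpTo-≤ f {zero}  z≤n = ≤-refl
minUpTo-≤ f {suc m} s≤1+m with m≤n⇒m<n∨m≡n s≤1+m
... | inj₁ (s≤s s≤m) = ≤-trans (p⊓q≤p (minUpTo f m) (f (suc m))) (minUpTo-≤ f s≤m)
... | inj₂ refl      = p⊓q≤q (minUpTo f m) (f (suc m))

minUpTo-attained : ∀ f m → ∃[ t ] t ℕ.≤ m × minUpTo f m ≡ f t
minUpTo-attained f zero = 0 , z≤n , refl
minUpTo-attained f (suc m) with ⊓-sel (minUpTo f m) (f (suc m))
... | inj₂ min≡last = suc m , ℕ.≤-refl , min≡last
... | inj₁ min≡prev with minUpTo-attained f m
...   | t , t≤m , eq = t , ℕ.m≤n⇒m≤1+n t≤m , trans min≡prev eq

module _ {n : ℕ} {δ : ℚ} (A B : Matrix) (0≤δ : 0ℚ ℚ.≤ δ)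
         (bdA : BoundedDiff n δ A) (bdB : BoundedDiff n δ B) where

  ∣blockPath-path∣≤4Lδ : ∀ L .{{_ : NonZero L}} {i k j} → i ℕ.< n → k ℕ.< n → j ℕ.< n →
    let i′ = i / L ℕ.* L; k′ = k / L ℕ.* L; j′ = j / L ℕ.* L; Lδ = ℕ→ℚ L * δ in
    ∣ (A i′ k′ + B k′ j′) - (A i k + B k j) ∣ ℚ.≤ (Lδ + Lδ) + (Lδ + Lδ)
  ∣blockPath-path∣≤4Lδ L {i} {k} {j} i<n k<n j<n =
    ≤-trans (∣p+q-[r+s]∣≤∣p-r∣+∣q-s∣ (A i′ k′) (B k′ j′) (A i k) (B k j))
            (+-mono-≤ (BoundedDiff-block-corner A bdA 0≤δ L i<n k<n)
                      (BoundedDiff-block-corner B bdB 0≤δ L k<n j<n))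
    where
    i′ = i / L ℕ.* L
    k′ = k / L ℕ.* L
    j′ = j / L ℕ.* L

  minPlus≤blockPath+4Lδ : ∀ L .{{_ : NonZero L}} {i j t} → i ℕ.< n → j ℕ.< n → t ℕ.≤ n / L ∸ 1 →
    let i′ = i / L ℕ.* L; j′ = j / L ℕ.* L; s = t ℕ.* L; Lδ = ℕ→ℚ L * δ in
    minPlus n A B i j ℚ.≤ (A i′ s + B s j′) + ((Lδ + Lδ) + (Lδ + Lδ))
  minPlus≤blockPath+4Lδ L {i} {j} {t} i<n j<n t≤ = begin
    minPlus n A B i j                          ≤⟨ minUpTo-≤ (λ k → A i k + B k j) (m<n⇒m≤n∸1 s<n) ⟩
    A i s + B s j                              ≤⟨ ∣p-q∣≤r⇒q≤p+r {A i′ s′ + B s′ j′} (∣blockPath-path∣≤4Lδ L i<n s<n j<n) ⟩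
    (A i′ s′ + B s′ j′) + ε                    ≡⟨ cong (λ x → (A i′ x + B x j′) + ε) (m*n/n*n≡m*n t L) ⟩
    (A i′ s + B s j′) + ε                      ∎
    where
    open ≤-Reasoning
    i′ = i / L ℕ.* L
    j′ = j / L ℕ.* L
    ε = (ℕ→ℚ L * δ + ℕ→ℚ L * δ) + (ℕ→ℚ L * δ + ℕ→ℚ L * δ)
    s = t ℕ.* L
    s′ = s / L ℕ.* L
    s<n : s ℕ.< n
    s<n = m≤n/o∸1⇒m*o<n (≤-<-trans z≤n i<n) t≤

  minPlus≤Ctilde+4Lδ : ∀ q {i j} → i ℕ.< n → j ℕ.< n → let Lδ = ℕ→ℚ (2 ^ q) * δ in
    minPlus n A B i j ℚ.≤ Ctilde n q A B (blockStart q i) (blockStart q j) + ((Lδ + Lδ) + (Lδ + Lδ))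
  minPlus≤Ctilde+4Lδ q {i} {j} i<n j<n =
    let t , t≤ , C̃≡ = minUpTo-attained (λ t → A (blockStart q i) (t ℕ.* 2 ^ q) + B (t ℕ.* 2 ^ q) (blockStart q j))
                                       (n / 2 ^ q ∸ 1)
    in subst (λ c → minPlus n A B i j ℚ.≤ c + _) (sym C̃≡) (minPlus≤blockPath+4Lδ (2 ^ q) i<n j<n t≤)
    where instance _ = m^n≢0 2 q

k≡m*[1-α]⇒k≤m : ∀ {m k α} → 0ℚ ℚ.≤ α → ℕ→ℚ k ≡ ℕ→ℚ m * (1ℚ - α) → k ℕ.≤ m
k≡m*[1-α]⇒k≤m {m} {k} {α} 0≤α k≡m[1-α] = ℕ→ℚ-cancel-≤ (begin
  ℕ→ℚ k              ≡⟨ k≡m[1-α] ⟩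
  ℕ→ℚ m * (1ℚ - α)   ≤⟨ *-monoˡ-≤-nonNeg (ℕ→ℚ m) {{nonNegative (ℕ→ℚ-mono-≤ {0} {m} z≤n)}} 1-α≤1 ⟩
  ℕ→ℚ m * 1ℚ         ≡⟨ *-identityʳ (ℕ→ℚ m) ⟩
  ℕ→ℚ m              ∎)
  where
  open ≤-Reasoning
  1-α≤1 : 1ℚ - α ℚ.≤ 1ℚ
  1-α≤1 = +-monoʳ-≤ 1ℚ (neg-antimono-≤ 0≤α)

corollary1 : (n p q : ℕ) → n ≡ 2 ^ p →
    (α : ℚ) → 0ℚ ℚ.< α → α ℚ.< 1ℚ → ℕ→ℚ q ≡ ℕ→ℚ p * (1ℚ - α) →
    (δ : ℚ) → 0ℚ ℚ.< δ →
    (A B : Matrix) → BoundedDiff n δ A → BoundedDiff n δ B →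
    (i j k : ℕ) → i ℕ.< n → j ℕ.< n → k ℕ.< n →
    minPlus n A B i j ≡ A i k + B k j →
    InK n q δ A B (blockStart q i) (blockStart q j) (blockStart q k)
corollary1 n p q n≡2^p α 0<α _ q≡p[1-α] δ 0<δ A B bdA bdB i j k i<n j<n k<n C≡ =
  blockStart∈InBlockStarts q 2^q∣n k<n , (begin
    A i′ k′ + B k′ j′         ≤⟨ ∣p-q∣≤r⇒p≤q+r (∣blockPath-path∣≤4Lδ A B 0≤δ bdA bdB L i<n k<n j<n) ⟩
    (A i k + B k j) + ε       ≡⟨ cong (_+ ε) C≡ ⟨
    minPlus n A B i j + ε     ≤⟨ +-monoˡ-≤ ε (minPlus≤Ctilde+4Lδ A B 0≤δ bdA bdB q i<n j<n) ⟩
    (C̃ + ε) + ε               ≡⟨ 4Lδ+4Lδ≡8δL C̃ (ℕ→ℚ L) δ ⟩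
    C̃ + ℕ→ℚ 8 * δ * ℕ→ℚ L    ∎)
  where
  open ≤-Reasoning
  L = 2 ^ q
  instance _ = m^n≢0 2 q
  i′ = blockStart q i
  j′ = blockStart q j
  k′ = blockStart q k
  C̃ = Ctilde n q A B i′ j′
  0≤δ = <⇒≤ 0<δ
  ε = (ℕ→ℚ L * δ + ℕ→ℚ L * δ) + (ℕ→ℚ L * δ + ℕ→ℚ L * δ)
  2^q∣n : L ∣ n
  2^q∣n = subst (L ∣_) (sym n≡2^p) (^-monoʳ-∣ 2 (k≡m*[1-α]⇒k≤m {p} {q} (<⇒≤ 0<α) q≡p[1-α]))
  4Lδ+4Lδ≡8δL : ∀ c l δ → (c + ((l * δ + l * δ) + (l * δ + l * δ))) + ((l * δ + l * δ) + (l * δ + l * δ))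
                         ≡ c + ℕ→ℚ 8 * δ * l
  4Lδ+4Lδ≡8δL = solve-∀ ℚ-ring
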